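{- Let $k\in\mathbb N$ and $A\subseteq\mathbb Z_{2k}\setminus\{0\}$ with $A=-A$. If $C_{2k}(A)$ is twin-free and has co-twins, then $k$ is odd.
   Context: The circulant graph $C_n(A)$ has vertex set $\mathbb Z_n$, with $u,v$ adjacent iff $u-v\in A$. A graph is twin-free if it has no two distinct vertices with equal open neighborhoods $N(u)=N(v)$ and no two distinct vertices with equal closed neighborhoods $N[u]=N[v]$. Co-twins means nonadjacent co-twins: distinct vertices $u,v$ with $N[u]\cap N[v]=\emptyset$ and $N[u]\cup N[v]$ equal to the whole vertex set. -}

module Defs where

open import Data.Nat using (ℕ; suc; _+_; _∸_; NonZero)
open import Data.Nat.DivMod using (_mod_)
open import Data.Fin using (Fin; toℕ; zero)
open import Data.Fin.Subset using (Subset; _∈_; _∉_)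
open import Data.Sum using (_⊎_)
open import Data.Product using (_×_; Σ-syntax)
open import Relation.Binary.PropositionalEquality using (_≡_)
open import Relation.Nullary using (¬_)
open import Function.Bundles using (_⇔_)

sub : (n : ℕ) .{{_ : NonZero n}} → Fin n → Fin n → Fin n
sub n u v = (toℕ u + (n ∸ toℕ v)) mod n

neg : (n : ℕ) .{{_ : NonZero n}} → Fin n → Fin n
neg n v = (n ∸ toℕ v) mod n

IsConnectionSet : (n : ℕ) .{{_ : NonZero n}} → Subset n → Set
IsConnectionSet n A =
  ((x : Fin n) → toℕ x ≡ 0 → x ∉ A) ×
  ((x : Fin n) → x ∈ A → neg n x ∈ A)

Adj : (n : ℕ) .{{_ : NonZero n}} → Subset n → Fin n → Fin n → Set
Adj n A u v = sub n u v ∈ A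

InClosedNbhd : (n : ℕ) .{{_ : NonZero n}} → Subset n → Fin n → Fin n → Set
InClosedNbhd n A u w = (w ≡ u) ⊎ Adj n A u w

TwinFree : (n : ℕ) .{{_ : NonZero n}} → Subset n → Set
TwinFree n A =
  ((u v : Fin n) → ¬ (u ≡ v) → ¬ ((w : Fin n) → Adj n A u w ⇔ Adj n A v w)) ×
  ((u v : Fin n) → ¬ (u ≡ v) → ¬ ((w : Fin n) → InClosedNbhd n A u w ⇔ InClosedNbhd n A v w))

CoTwins : (n : ℕ) .{{_ : NonZero n}} → Subset n → Fin n → Fin n → Set
CoTwins n A u v =
  ¬ (u ≡ v) ×
  ((w : Fin n) → ¬ (InClosedNbhd n A u w × InClosedNbhd n A v w)) ×
  ((w : Fin n) → InClosedNbhd n A u w ⊎ InClosedNbhd n A v w)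

HasCoTwins : (n : ℕ) .{{_ : NonZero n}} → Subset n → Set
HasCoTwins n A = Σ[ u ∈ Fin n ] Σ[ v ∈ Fin n ] CoTwins n A u v

{-# OPTIONS --safe #-}
-- Write A₀ = A ∪ {0}, so that w ∈ N[u] iff u − w ∈ A₀. If u, v are co-twins, then for every y
-- exactly one of y and y + d lies in A₀, where d = v − u. Hence A₀ is invariant under translation
-- by 2d, so u + 2d and u are closed twins, and twin-freeness forces 2d = 0; as d ≠ 0, d = k.
-- If k = 2j, then j + k = −j, and A₀ = −A₀ puts j and j + k both in A₀ or both outside it.
module Submission where

open import Defs
open import Data.Nat using (ℕ; _+_; _*_; _∸_; _≤_; _<_; NonZero; _<?_)
open import Data.Nat.Properties
open import Data.Nat.DivMod
open import Data.Nat.Divisibility using (_∣_; divides)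
open import Data.Nat.Tactic.RingSolver using (solve-∀)
open import Data.Fin using (Fin; toℕ)
import Data.Fin.Properties as Fin
open import Data.Fin.Subset using (Subset; _∈_)
open import Data.Product using (Σ-syntax; _,_; proj₁; proj₂)
open import Data.Sum using (_⊎_; inj₁; inj₂; [_,_])
import Data.Sum
open import Data.Empty using (⊥-elim)
open import Function.Bundles using (_⇔_; mk⇔; Equivalence)
open import Function.Properties.Equivalence using (⇔-setoid)
open import Level using (0ℓ)
open import Relation.Binary.Bundles using (Setoid)
import Relation.Binary.Construct.On as On
import Relation.Binary.Reasoning.Setoid as SetoidReasoning
open import Relation.Binary.PropositionalEquality as ≡ using (_≡_; refl; cong)
open import Relation.Nullary using (¬_; yes; no)

module Residues (n : ℕ) .{{_ : NonZero n}} where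

  infix 4 _≈_
  _≈_ : ℕ → ℕ → Set
  x ≈ y = x % n ≡ y % n

  ≈-setoid : Setoid 0ℓ 0ℓ
  ≈-setoid = On.setoid (≡.setoid ℕ) (_% n)

  open Setoid ≈-setoid public using () renaming (refl to ≈-refl; sym to ≈-sym; trans to ≈-trans)
  module ≈-Reasoning = SetoidReasoning ≈-setoid

  ≡⇒≈ : ∀ {x y} → x ≡ y → x ≈ y
  ≡⇒≈ = cong (_% n)

  %-≈ : ∀ x → x % n ≈ x
  %-≈ x = m%n%n≡m%n x n

  +n-≈ : ∀ x → x + n ≈ x
  +n-≈ x = [m+n]%n≡m%n x n

  0%n≡0 : 0 % n ≡ 0
  0%n≡0 = m*n%n≡0 0 n

  ≈0⇒%≡0 : ∀ {x} → x ≈ 0 → x % n ≡ 0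
  ≈0⇒%≡0 x≈0 = ≡.trans x≈0 0%n≡0

  +-cong-≈ : ∀ {x x′ y y′} → x ≈ x′ → y ≈ y′ → x + y ≈ x′ + y′
  +-cong-≈ {x} {x′} {y} {y′} x≈x′ y≈y′ = begin
    (x + y) % n                 ≡⟨ %-distribˡ-+ x y n ⟩
    (x % n + y % n) % n         ≡⟨ ≡.cong₂ (λ p q → (p + q) % n) x≈x′ y≈y′ ⟩
    (x′ % n + y′ % n) % n       ≡⟨ %-distribˡ-+ x′ y′ n ⟨
    (x′ + y′) % n               ∎
    where open ≡.≡-Reasoning

  +-∸-cancel : ∀ x {c} → c ≤ n → x + (n ∸ c) + c ≈ x
  +-∸-cancel x {c} c≤n = begin
    x + (n ∸ c) + c    ≡⟨ +-assoc x (n ∸ c) c ⟩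
    x + (n ∸ c + c)    ≡⟨ cong (x +_) (m∸n+n≡m c≤n) ⟩
    x + n              ≈⟨ +n-≈ x ⟩
    x                  ∎
    where open ≈-Reasoning

  +-inverseʳ : ∀ x z → x + z + (n ∸ z % n) ≈ x
  +-inverseʳ x z = begin
    x + z + (n ∸ z % n)        ≈⟨ +-cong-≈ (+-cong-≈ {x} ≈-refl (%-≈ z)) ≈-refl ⟨
    x + z % n + (n ∸ z % n)    ≡⟨ +-assoc x (z % n) _ ⟩
    x + (z % n + (n ∸ z % n))  ≡⟨ cong (x +_) (m+[n∸m]≡n (m%n≤n z n)) ⟩
    x + n                      ≈⟨ +n-≈ x ⟩
    x                          ∎
    where open ≈-Reasoning

  +-cancelʳ-≈ : ∀ {x y} z → x + z ≈ y + z → x ≈ y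
  +-cancelʳ-≈ {x} {y} z x+z≈y+z = begin
    x                       ≈⟨ +-inverseʳ x z ⟨
    x + z + (n ∸ z % n)     ≈⟨ +-cong-≈ x+z≈y+z ≈-refl ⟩
    y + z + (n ∸ z % n)     ≈⟨ +-inverseʳ y z ⟩
    y                       ∎
    where open ≈-Reasoning

  ∸-inverse : ∀ {c y} → c ≤ n → c + y ≈ 0 → n ∸ c ≈ y
  ∸-inverse {c} {y} c≤n c+y≈0 = +-cancelʳ-≈ c (begin
    n ∸ c + c    ≡⟨ m∸n+n≡m c≤n ⟩
    n            ≈⟨ +n-≈ 0 ⟩
    0            ≈⟨ c+y≈0 ⟨
    c + y        ≡⟨ +-comm c y ⟩
    y + c        ∎)
    where open ≈-Reasoning

  toℕ-mod : ∀ x → toℕ (x mod n) ≈ x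
  toℕ-mod x = ≡.trans (≡⇒≈ (Fin.toℕ-fromℕ< _)) (%-≈ x)

  mod-cong : ∀ {x y} → x ≈ y → x mod n ≡ y mod n
  mod-cong x≈y = Fin.fromℕ<-cong _ _ x≈y _ _

  mod-injective : ∀ {x y} → x mod n ≡ y mod n → x ≈ y
  mod-injective eq =
    ≡.trans (≡.sym (Fin.toℕ-fromℕ< _)) (≡.trans (cong toℕ eq) (Fin.toℕ-fromℕ< _))

  toℕ-≈-injective : ∀ {u w : Fin n} → toℕ u ≈ toℕ w → u ≡ w
  toℕ-≈-injective {u} {w} u≈w = Fin.toℕ-injective
    (≡.trans (≡.sym (m<n⇒m%n≡m (Fin.toℕ<n u))) (≡.trans u≈w (m<n⇒m%n≡m (Fin.toℕ<n w))))

  ∸-surjective : ∀ a y → Σ[ w ∈ Fin n ] a + (n ∸ toℕ w) ≈ y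
  ∸-surjective a y = w , +-cancelʳ-≈ (toℕ w) (begin
    a + (n ∸ toℕ w) + toℕ w       ≈⟨ +-∸-cancel a (<⇒≤ (Fin.toℕ<n w)) ⟩
    a                             ≈⟨ +-inverseʳ a y ⟨
    a + y + (n ∸ y % n)           ≡⟨ cong (_+ (n ∸ y % n)) (+-comm a y) ⟩
    y + a + (n ∸ y % n)           ≡⟨ +-assoc y a _ ⟩
    y + (a + (n ∸ y % n))         ≈⟨ +-cong-≈ {y} ≈-refl (toℕ-mod _) ⟨
    y + toℕ w                     ∎)
    where
    open ≈-Reasoning
    w = (a + (n ∸ y % n)) mod n

  ∸-telescope : ∀ a b c → a ≤ n → b + (n ∸ c) ≈ a + (n ∸ c) + (b + (n ∸ a))
  ∸-telescope a b c a≤n = ≈-sym (begin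
    a + (n ∸ c) + (b + (n ∸ a))   ≡⟨ rearrange a (n ∸ c) b (n ∸ a) ⟩
    b + (n ∸ c) + (n ∸ a) + a     ≈⟨ +-∸-cancel (b + (n ∸ c)) a≤n ⟩
    b + (n ∸ c)                   ∎)
    where
    open ≈-Reasoning
    rearrange : ∀ a x b z → a + x + (b + z) ≡ b + x + z + a
    rearrange = solve-∀

  e+e%n≡0⇒e+e≡n : ∀ {e} → e < n → ¬ e ≡ 0 → (e + e) % n ≡ 0 → e + e ≡ n
  e+e%n≡0⇒e+e≡n {e} e<n e≢0 2e%n≡0 with e + e <? n
  ... | yes 2e<n = ⊥-elim (e≢0 (m+n≡0⇒m≡0 e (≡.trans (≡.sym (m<n⇒m%n≡m 2e<n)) 2e%n≡0)))
  ... | no 2e≮n = ≤-antisym (m∸n≡0⇒m≤n 2e∸n≡0) n≤2e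
    where
    n≤2e : n ≤ e + e
    n≤2e = ≮⇒≥ 2e≮n
    2e∸n≡0 : e + e ∸ n ≡ 0
    2e∸n≡0 = ≡.trans (≡.sym (m<n⇒m%n≡m (m<n+o⇒m∸n<o (e + e) n (+-mono-< e<n e<n))))
               (≡.trans (m≤n⇒[n∸m]%m≡n%m n≤2e) 2e%n≡0)

  d+d≈0⇒d%n+d%n≡n : ∀ {d} → d + d ≈ 0 → ¬ d ≈ 0 → d % n + d % n ≡ n
  d+d≈0⇒d%n+d%n≡n {d} 2d≈0 d≉0 = e+e%n≡0⇒e+e≡n (m%n<n d n)
    (λ d%n≡0 → d≉0 (≡.trans d%n≡0 (≡.sym 0%n≡0)))
    (≈0⇒%≡0 (≈-trans (+-cong-≈ (%-≈ d) (%-≈ d)) 2d≈0))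

module Circulant (n : ℕ) .{{_ : NonZero n}} (A : Subset n) where
  open Residues n

  A₀ : ℕ → Set
  A₀ y = y ≈ 0 ⊎ y mod n ∈ A

  A₀-resp-≈ : ∀ {x y} → x ≈ y → A₀ x → A₀ y
  A₀-resp-≈ x≈y (inj₁ x≈0) = inj₁ (≈-trans (≈-sym x≈y) x≈0)
  A₀-resp-≈ x≈y (inj₂ x∈A) = inj₂ (≡.subst (_∈ A) (mod-cong x≈y) x∈A)

  A₀-neg : IsConnectionSet n A → ∀ {x y} → x + y ≈ 0 → A₀ x → A₀ y
  A₀-neg _ x+y≈0 (inj₁ x≈0) = inj₁ (≈-trans (+-cong-≈ {0} (≈-sym x≈0) ≈-refl) x+y≈0)
  A₀-neg (_ , neg-closed) {x} {y} x+y≈0 (inj₂ x∈A) =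
    inj₂ (≡.subst (_∈ A) (mod-cong (∸-inverse (<⇒≤ (Fin.toℕ<n (x mod n))) c+y≈0)) (neg-closed _ x∈A))
    where
    c+y≈0 : toℕ (x mod n) + y ≈ 0
    c+y≈0 = ≈-trans (+-cong-≈ (toℕ-mod x) ≈-refl) x+y≈0

  closedNbhd⇔A₀ : ∀ {u w y} → toℕ u + (n ∸ toℕ w) ≈ y → InClosedNbhd n A u w ⇔ A₀ y
  closedNbhd⇔A₀ {u} {w} {y} u-w≈y = mk⇔ to from
    where
    a = toℕ u
    c = toℕ w
    u-u≈0 : a + (n ∸ a) ≈ 0
    u-u≈0 = ≈-trans (≡⇒≈ (m+[n∸m]≡n (<⇒≤ (Fin.toℕ<n u)))) (+n-≈ 0)
    to : InClosedNbhd n A u w → A₀ y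
    to (inj₁ refl) = A₀-resp-≈ u-w≈y (inj₁ u-u≈0)
    to (inj₂ adj)  = A₀-resp-≈ u-w≈y (inj₂ adj)
    from : A₀ y → InClosedNbhd n A u w
    from A₀y with A₀-resp-≈ (≈-sym u-w≈y) A₀y
    ... | inj₂ adj   = inj₂ adj
    ... | inj₁ u-w≈0 = inj₁ (≡.sym (toℕ-≈-injective (begin
      a                ≈⟨ +-∸-cancel a (<⇒≤ (Fin.toℕ<n w)) ⟨
      a + (n ∸ c) + c  ≈⟨ +-cong-≈ u-w≈0 ≈-refl ⟩
      c                ∎)))
      where open ≈-Reasoning

  record ShiftComplements (d : ℕ) : Set where
    field
      cover    : ∀ y → A₀ y ⊎ A₀ (y + d)
      disjoint : ∀ y → A₀ y → ¬ A₀ (y + d)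

  coTwins⇒shiftComplements : ∀ {u v} → CoTwins n A u v → ShiftComplements (toℕ v + (n ∸ toℕ u))
  coTwins⇒shiftComplements {u} {v} (_ , nbhds-disjoint , nbhds-cover) = record
    { cover    = λ y → Data.Sum.map (to (u-sees y)) (to (v-sees y)) (nbhds-cover (w y))
    ; disjoint = λ y A₀y A₀y+d → nbhds-disjoint (w y) (from (u-sees y) A₀y , from (v-sees y) A₀y+d)
    }
    where
    open Equivalence
    d = toℕ v + (n ∸ toℕ u)
    w : ℕ → Fin n
    w y = proj₁ (∸-surjective (toℕ u) y)
    u-sees : ∀ y → InClosedNbhd n A u (w y) ⇔ A₀ y
    u-sees y = closedNbhd⇔A₀ (proj₂ (∸-surjective (toℕ u) y))
    v-sees : ∀ y → InClosedNbhd n A v (w y) ⇔ A₀ (y + d)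
    v-sees y = closedNbhd⇔A₀ (≈-trans (∸-telescope (toℕ u) (toℕ v) (toℕ (w y)) (<⇒≤ (Fin.toℕ<n u)))
                                      (+-cong-≈ (proj₂ (∸-surjective (toℕ u) y)) ≈-refl))

  shiftComplements⇒≉0 : ∀ {d} → ShiftComplements d → ¬ d ≈ 0
  shiftComplements⇒≉0 complements d≈0 = ShiftComplements.disjoint complements 0 (inj₁ ≈-refl) (inj₁ d≈0)

  IsPeriod : ℕ → Set
  IsPeriod p = ∀ y → A₀ (y + p) ⇔ A₀ y

  shiftComplements⇒period : ∀ {d} → ShiftComplements d → IsPeriod (d + d)
  shiftComplements⇒period {d} complements y = mk⇔ backward forward
    where
    open ShiftComplements complements
    backward : A₀ (y + (d + d)) → A₀ y
    backward A₀y+2d with cover y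
    ... | inj₁ A₀y   = A₀y
    ... | inj₂ A₀y+d = ⊥-elim (disjoint (y + d) A₀y+d (≡.subst A₀ (≡.sym (+-assoc y d d)) A₀y+2d))
    forward : A₀ y → A₀ (y + (d + d))
    forward A₀y with cover (y + d)
    ... | inj₁ A₀y+d  = ⊥-elim (disjoint y A₀y A₀y+d)
    ... | inj₂ A₀y+2d = ≡.subst A₀ (+-assoc y d d) A₀y+2d

  twinFree⇒period≈0 : ∀ {p} → TwinFree n A → IsPeriod p → p ≈ 0
  twinFree⇒period≈0 {p} (_ , no-closed-twins) period with p mod n Fin.≟ 0 mod n
  ... | yes p≡0 = mod-injective p≡0
  ... | no p≢0  = ⊥-elim (no-closed-twins (p mod n) (0 mod n) p≢0 closed-twins)
    where
    closed-twins : ∀ w → InClosedNbhd n A (p mod n) w ⇔ InClosedNbhd n A (0 mod n) w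
    closed-twins w = begin
      InClosedNbhd n A (p mod n) w  ≈⟨ closedNbhd⇔A₀ (≈-trans (+-cong-≈ (toℕ-mod p) ≈-refl) (≡⇒≈ (+-comm p _))) ⟩
      A₀ (n ∸ toℕ w + p)            ≈⟨ period (n ∸ toℕ w) ⟩
      A₀ (n ∸ toℕ w)                ≈⟨ closedNbhd⇔A₀ (+-cong-≈ (toℕ-mod 0) ≈-refl) ⟨
      InClosedNbhd n A (0 mod n) w  ∎
      where open SetoidReasoning (⇔-setoid 0ℓ)

  shiftComplements⇒y+y+d≉0 : ∀ {d} → IsConnectionSet n A → ShiftComplements d → ∀ y → ¬ y + y + d ≈ 0
  shiftComplements⇒y+y+d≉0 {d} connectionSet complements y y+y+d≈0 =
    [ (λ A₀y   → disjoint y A₀y (A₀-neg connectionSet y+[y+d]≈0 A₀y))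
    , (λ A₀y+d → disjoint y (A₀-neg connectionSet [y+d]+y≈0 A₀y+d) A₀y+d)
    ] (cover y)
    where
    open ShiftComplements complements
    y+[y+d]≈0 : y + (y + d) ≈ 0
    y+[y+d]≈0 = ≈-trans (≡⇒≈ (≡.sym (+-assoc y y d))) y+y+d≈0
    [y+d]+y≈0 : y + d + y ≈ 0
    [y+d]+y≈0 = ≈-trans (≡⇒≈ (≡.trans (+-comm (y + d) y) (≡.sym (+-assoc y y d)))) y+y+d≈0

corollary31 : (k : ℕ) .{{_ : NonZero k}} (A : Subset (2 * k)) →
    IsConnectionSet (2 * k) {{m*n≢0 2 k}} A →
    TwinFree (2 * k) {{m*n≢0 2 k}} A →
    HasCoTwins (2 * k) {{m*n≢0 2 k}} A →
    ¬ (2 ∣ k)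
corollary31 k A connectionSet twinFree (u , v , coTwins) (divides j k≡j*2) =
  shiftComplements⇒y+y+d≉0 connectionSet complements j j+j+d≈0
  where
  instance
    2k≢0 : NonZero (2 * k)
    2k≢0 = m*n≢0 2 k
  open Residues (2 * k)
  open Circulant (2 * k) A
  d = toℕ v + (2 * k ∸ toℕ u)
  complements : ShiftComplements d
  complements = coTwins⇒shiftComplements coTwins
  d%2k≡k : d % (2 * k) ≡ k
  d%2k≡k = *-cancelˡ-≡ _ _ 2 (≡.trans (cong (d % (2 * k) +_) (+-identityʳ _))
    (d+d≈0⇒d%n+d%n≡n (twinFree⇒period≈0 twinFree (shiftComplements⇒period complements))
               (shiftComplements⇒≉0 complements)))
  j+j≡k : j + j ≡ k
  j+j≡k = ≡.sym (≡.trans k≡j*2 (≡.trans (*-comm j 2) (cong (j +_) (+-identityʳ j))))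
  j+j+d≈0 : j + j + d ≈ 0
  j+j+d≈0 = begin
    j + j + d              ≈⟨ +-cong-≈ {j + j} ≈-refl (%-≈ d) ⟨
    j + j + d % (2 * k)    ≡⟨ ≡.cong₂ _+_ j+j≡k d%2k≡k ⟩
    k + k                  ≡⟨ cong (k +_) (+-identityʳ k) ⟨
    2 * k                  ≈⟨ +n-≈ 0 ⟩
    0                      ∎
    where open ≈-Reasoning
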